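{- Fix an integer $n\ge0$. In each row $i$ (the points $(x,y)$ with $x+y=i$, read from left to right, i.e. in order of increasing $y$), the entries of $F$ strictly increase from the leftmost nonzero entry up to the middle of the row. More precisely, for integers $x,y$ with $F(x+1,y-1)>0$: if $y<x$, then $F(x,y)-F(x+1,y-1)\ge 2$; and if $y=x$, then $F(x,y)-F(x+1,y-1)\ge1$. By the symmetry $F(x,y)=F(y,x)$, the entries of each row correspondingly decrease in the right half.
   Context: For a fixed integer $n\ge0$, define $F:\mathbb{Z}^2\to\mathbb{Z}_{\ge0}$ by $F(0,0)=2^n$, $F(x,y)=\lfloor F(x-1,y)/2\rfloor+\lfloor F(x,y-1)/2\rfloor$ for every $(x,y)\in\mathbb{Z}_{\ge0}^2\setminus\{(0,0)\}$, and $F(x,y)=0$ for $(x,y)$ outside the first quadrant. This is the intermediate firing configuration of chip-firing on the quadrant lattice graph (vertices $\mathbb{Z}_{\ge0}^2$, edges $(x,y)\to(x+1,y)$, $(x,y)\to(x,y+1)$; a vertex with at least 2 chips fires one chip to each out-neighbour) started with $2^n$ chips at the origin and fired row by row. For two points $(a,b),(c,d)$ in the same row, $(a,b)$ is left of $(c,d)$ if $b<d$. -}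

module Defs where

open import Data.Nat using (ℕ; zero; suc; _+_; _^_; _/_)
open import Data.Integer using (ℤ; +_; -[1+_])

-- F restricted to the first quadrant (x,y ∈ ℕ), for the fixed parameter n:
-- Fℕ n 0 0 = 2^n, Fℕ n x y = ⌊Fℕ n (x-1) y / 2⌋ + ⌊Fℕ n x (y-1) / 2⌋,
-- with out-of-quadrant terms equal to 0 (so those summands are dropped).
Fℕ : ℕ → ℕ → ℕ → ℕ
Fℕ n zero    zero    = 2 ^ n
Fℕ n (suc x) zero    = Fℕ n x zero / 2
Fℕ n zero    (suc y) = Fℕ n zero y / 2
Fℕ n (suc x) (suc y) = Fℕ n x (suc y) / 2 + Fℕ n (suc x) y / 2

F : ℕ → ℤ → ℤ → ℕ
F n (+ x)     (+ y)     = Fℕ n x y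
F n (+ x)     -[1+ _ ]  = 0
F n -[1+ _ ]  _         = 0

{-# OPTIONS --safe #-}
-- If E, P, D are consecutive entries of a row, the entries of the
-- next row between them are P/2 + E/2 and D/2 + P/2, so their difference is that of D/2 and E/2.
-- A gap E + 2 ≤ P survives halving as E/2 < P/2, and so does P < D just before the diagonal,
-- because the diagonal entry F(k+1,k+1) = 2⌊F(k+1,k)/2⌋ is even by symmetry; so E/2 < P/2 < D/2
-- gives the gap 2. At the middle of the row D = P by symmetry, giving the gap 1. At the left end of a
-- row (E = 0) positivity of the next entry P/2 forces P ≥ 2 = E + 2.
module Submission where

open import Defs
open import Data.Nat using (ℕ; zero; suc; _+_; _*_; _/_; _≤_; _<_; z≤n; s≤s; z<s)
open import Data.Nat.Divisibility using (_∣_; divides)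
open import Data.Nat.DivMod using (m/n≡1+[m∸n]/n; /-monoˡ-≤; m<n*o⇒m/o<n; m*n/n≡m; m/n≢0⇒n≤m)
open import Data.Nat.Properties using (+-comm; +-assoc; +-identityʳ; *-comm; +-monoˡ-≤; +-monoʳ-≤; ≤-refl; ≤-trans; m≤n⇒m≤1+n; m+n≤o⇒n≤o; m≤n⇒m<n∨m≡n; n>0⇒n≢0; module ≤-Reasoning)
open import Data.Integer using (ℤ; +_; -[1+_]; +<+; 1ℤ) renaming (_+_ to _+ℤ_; _-_ to _-ℤ_; _<_ to _<ℤ_)
open import Data.Product using (_×_; _,_; proj₁; proj₂)
open import Data.Sum using (inj₁; inj₂)
open import Relation.Binary.PropositionalEquality using (_≡_; refl; sym; trans; cong; cong₂; subst; module ≡-Reasoning)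

m+2≤n⇒m/2+1≤n/2 : ∀ {m n} → m + 2 ≤ n → m / 2 + 1 ≤ n / 2
m+2≤n⇒m/2+1≤n/2 {m} {n} m+2≤n = begin
  m / 2 + 1    ≡⟨ +-comm (m / 2) 1 ⟩
  1 + m / 2    ≡⟨ m/n≡1+[m∸n]/n {2 + m} (s≤s (s≤s z≤n)) ⟨
  (2 + m) / 2  ≤⟨ /-monoˡ-≤ 2 (subst (_≤ n) (+-comm m 2) m+2≤n) ⟩
  n / 2        ∎
  where open ≤-Reasoning

m+1≤n⇒2∣n⇒m/2+1≤n/2 : ∀ {m n} → m + 1 ≤ n → 2 ∣ n → m / 2 + 1 ≤ n / 2
m+1≤n⇒2∣n⇒m/2+1≤n/2 {m} m+1≤n (divides q refl) = begin
  m / 2 + 1  ≡⟨ +-comm (m / 2) 1 ⟩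
  1 + m / 2  ≤⟨ m<n*o⇒m/o<n (subst (_≤ q * 2) (+-comm m 1) m+1≤n) ⟩
  q          ≡⟨ m*n/n≡m q 2 ⟨
  q * 2 / 2  ∎
  where open ≤-Reasoning

m+2≤n⇒n/2+1≤o/2⇒m/2+2≤o/2 : ∀ {m n o} → m + 2 ≤ n → n / 2 + 1 ≤ o / 2 → m / 2 + 2 ≤ o / 2
m+2≤n⇒n/2+1≤o/2⇒m/2+2≤o/2 {m} {n} {o} m+2≤n n/2+1≤o/2 = begin
  m / 2 + 2      ≡⟨ +-assoc (m / 2) 1 1 ⟨
  m / 2 + 1 + 1  ≤⟨ +-monoˡ-≤ 1 (m+2≤n⇒m/2+1≤n/2 m+2≤n) ⟩
  n / 2 + 1      ≤⟨ n/2+1≤o/2 ⟩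
  o / 2          ∎
  where open ≤-Reasoning

m≤n⇒o+m≤n+o : ∀ o {m n} → m ≤ n → o + m ≤ n + o
m≤n⇒o+m≤n+o o {m} {n} m≤n = subst (o + m ≤_) (+-comm o n) (+-monoʳ-≤ o m≤n)

m+k≤n⇒o+m+k≤n+o : ∀ o {m k n} → m + k ≤ n → o + m + k ≤ n + o
m+k≤n⇒o+m+k≤n+o o {m} {k} {n} m+k≤n = subst (_≤ n + o) (sym (+-assoc o m k)) (m≤n⇒o+m≤n+o o m+k≤n)

0<n/2+m/2⇒[0<m⇒m+2≤n]⇒m+2≤n : ∀ m n → 0 < n / 2 + m / 2 → (0 < m → m + 2 ≤ n) → m + 2 ≤ n
0<n/2+m/2⇒[0<m⇒m+2≤n]⇒m+2≤n zero    (suc (suc n)) _ _   = s≤s (s≤s z≤n)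
0<n/2+m/2⇒[0<m⇒m+2≤n]⇒m+2≤n (suc m) n             _ gap = gap z<s

module _ (n : ℕ) where

  Fℕ-sym : ∀ x y → Fℕ n x y ≡ Fℕ n y x
  Fℕ-sym zero    zero    = refl
  Fℕ-sym (suc x) zero    = cong (_/ 2) (Fℕ-sym x zero)
  Fℕ-sym zero    (suc y) = cong (_/ 2) (Fℕ-sym zero y)
  Fℕ-sym (suc x) (suc y) = trans
    (cong₂ _+_ (cong (_/ 2) (Fℕ-sym x (suc y))) (cong (_/ 2) (Fℕ-sym (suc x) y)))
    (+-comm (Fℕ n (suc y) x / 2) (Fℕ n y (suc x) / 2))

  Fℕ-diagonal-even : ∀ k → 2 ∣ Fℕ n (suc k) (suc k)
  Fℕ-diagonal-even k = divides w (begin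
    Fℕ n k (suc k) / 2 + w  ≡⟨ cong (λ z → z / 2 + w) (Fℕ-sym k (suc k)) ⟩
    w + w                   ≡⟨ cong (λ z → w + z) (+-identityʳ w) ⟨
    2 * w                   ≡⟨ *-comm 2 w ⟩
    w * 2                   ∎)
    where
    open ≡-Reasoning
    w : ℕ
    w = Fℕ n (suc k) k / 2

  IncreasesAt : ℕ → ℕ → Set
  IncreasesAt a b = 0 < Fℕ n (suc a) b →
    (suc b < a → Fℕ n (suc a) b + 2 ≤ Fℕ n a (suc b)) ×
    (suc b ≡ a → Fℕ n (suc a) b + 1 ≤ Fℕ n a (suc b))

  halves-increase : ∀ a b → IncreasesAt a b → 0 < Fℕ n (suc a) b → suc b ≤ a →
    Fℕ n (suc a) b / 2 + 1 ≤ Fℕ n a (suc b) / 2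
  halves-increase a b inc pos b<a with m≤n⇒m<n∨m≡n b<a
  ... | inj₁ 1+b<a = m+2≤n⇒m/2+1≤n/2 (proj₁ (inc pos) 1+b<a)
  ... | inj₂ refl  = m+1≤n⇒2∣n⇒m/2+1≤n/2 (proj₂ (inc pos) refl) (Fℕ-diagonal-even b)

  edge-step : ∀ a → IncreasesAt a 0 → IncreasesAt (suc a) 0
  edge-step a inc pos = strict , equal
    where
    P : ℕ
    P = Fℕ n (suc a) 0
    2≤P : 2 ≤ P
    2≤P = m/n≢0⇒n≤m (n>0⇒n≢0 pos)
    strict : 1 < suc a → P / 2 + 2 ≤ Fℕ n a 1 / 2 + P / 2
    strict (s≤s 1≤a) = m≤n⇒o+m≤n+o (P / 2)
      (m+2≤n⇒n/2+1≤o/2⇒m/2+2≤o/2 {0} {o = Fℕ n a 1} 2≤P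
        (halves-increase a 0 inc (≤-trans (s≤s z≤n) 2≤P) 1≤a))
    equal : 1 ≡ suc a → P / 2 + 1 ≤ Fℕ n a 1 / 2 + P / 2
    equal refl = m≤n⇒o+m≤n+o (P / 2) pos

  interior-step : ∀ a b → IncreasesAt (suc a) b → IncreasesAt a (suc b) → IncreasesAt (suc a) (suc b)
  interior-step a b incˡ incʳ pos = strict , equal
    where
    E P D : ℕ
    E = Fℕ n (suc (suc a)) b
    P = Fℕ n (suc a) (suc b)
    D = Fℕ n a (suc (suc b))
    E+2≤P : suc b < suc a → E + 2 ≤ P
    E+2≤P b<a = 0<n/2+m/2⇒[0<m⇒m+2≤n]⇒m+2≤n E P pos (λ 0<E → proj₁ (incˡ 0<E) b<a)
    strict : suc (suc b) < suc a → P / 2 + E / 2 + 2 ≤ D / 2 + P / 2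
    strict (s≤s 2+b≤a) = m+k≤n⇒o+m+k≤n+o (P / 2)
      (m+2≤n⇒n/2+1≤o/2⇒m/2+2≤o/2 {o = D} E+2≤P′ (halves-increase a (suc b) incʳ 0<P 2+b≤a))
      where
      E+2≤P′ : E + 2 ≤ P
      E+2≤P′ = E+2≤P (m≤n⇒m≤1+n 2+b≤a)
      0<P : 0 < P
      0<P = ≤-trans (s≤s z≤n) (m+n≤o⇒n≤o E E+2≤P′)
    equal : suc (suc b) ≡ suc a → P / 2 + E / 2 + 1 ≤ D / 2 + P / 2
    equal refl = m+k≤n⇒o+m+k≤n+o (P / 2)
      (subst (λ d → E / 2 + 1 ≤ d / 2) (Fℕ-sym (suc (suc b)) (suc b)) (m+2≤n⇒m/2+1≤n/2 (E+2≤P ≤-refl)))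

  increases : ∀ a b → IncreasesAt a b
  increases zero    b       _ = (λ ()) , (λ ())
  increases (suc a) zero      = edge-step a (increases a 0)
  increases (suc a) (suc b)   = interior-step a b (increases (suc a) b) (increases a (suc b))

proposition6p1 : (n : ℕ) (x y : ℤ) → 0 < F n (x +ℤ 1ℤ) (y -ℤ 1ℤ) →
    ((y <ℤ x → F n (x +ℤ 1ℤ) (y -ℤ 1ℤ) + 2 ≤ F n x y) ×
     (y ≡ x → F n (x +ℤ 1ℤ) (y -ℤ 1ℤ) + 1 ≤ F n x y))
-- In the missing cases F n (x +ℤ 1ℤ) (y -ℤ 1ℤ) reduces to 0, so they are absurd by `pos`.
proposition6p1 n (+ a) (+ suc b) pos rewrite +-comm a 1 with strict , equal ← increases n a b pos =
  (λ { (+<+ b<a) → strict b<a }) , (λ { refl → equal refl })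
proposition6p1 n -[1+ 0 ] (+ suc b) _ = (λ ()) , (λ ())
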